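{- Let $n\ge2$ and $w\in A_{n+1}$. Then $\ell_A(w)=\ell_S(w)-\mathrm{del}_S(w)$. Moreover, let $w=w_1\cdots w_n$ ($w_i\in R^S_i$) be the $S$ canonical presentation of $w$ in $S_{n+1}$ and $w=v_1\cdots v_{n-1}$ ($v_i\in R^A_i$) its $A$ canonical presentation. Then for each $1\le i\le n-1$, $\ell_A(v_i)=\ell_S(w_{i+1})$ if $s_1$ does not occur in $w_{i+1}$, and $\ell_A(v_i)=\ell_S(w_{i+1})-1$ if $s_1$ occurs in $w_{i+1}$.
   Context: Permutations are multiplied as functions, $(\sigma\tau)(k)=\sigma(\tau(k))$; $s_i=(i,i+1)$. In $S_{n+1}$, for $1\le j\le n$ let $R^S_j=\{1,s_j,s_js_{j-1},\dots,s_js_{j-1}\cdots s_1\}$ (as words); every $w\in S_{n+1}$ factors uniquely as $w=w_1\cdots w_n$ with $w_j\in R^S_j$ (the $S$ canonical presentation); $\ell_S$ of an element of $R^S_j$ or of $w$ is the number of letters $s_i$ in the corresponding word, and $\mathrm{del}_S(w)$ is the number of occurrences of $s_1$ in the $S$ canonical presentation. Let $a_i=s_1s_{i+1}$ ($1\le i\le n-1$), $R^A_j=\{1,a_j,a_ja_{j-1},\dots,a_j\cdots a_2,a_j\cdots a_2a_1,a_j\cdots a_2a_1^{ -1}\}$ (words; $R^A_1=\{1,a_1,a_1^{ -1}\}$). Every $v\in A_{n+1}$ factors uniquely as $v_1\cdots v_{n-1}$ with $v_j\in R^A_j$ (the $A$ canonical presentation); $\ell_A$ of an element of $R^A_j$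 or of $v$ is the number of letters $a_i^{\pm1}$ in the corresponding word. -}

module Defs where

open import Data.Nat using (ℕ; zero; suc; pred; _≡ᵇ_)
open import Data.Bool using (if_then_else_)
open import Data.List using (List; []; _∷_; _++_)
open import Function using (id; _∘_)

-- Permutations of {1,…,N} are modelled as functions ℕ → ℕ (identity off {1,…,N});
-- multiplication is composition: (σ τ)(k) = σ (τ k).

s : ℕ → ℕ → ℕ
s i k = if k ≡ᵇ i then suc i else (if k ≡ᵇ suc i then i else k)

evalS : List ℕ → ℕ → ℕ
evalS []      = id
evalS (i ∷ w) = s i ∘ evalS w

data ALetter : Set where
  a    : ℕ → ALetter
  a⁻¹  : ℕ → ALetter

evalLetter : ALetter → ℕ → ℕ
evalLetter (a i)   = s 1 ∘ s (suc i)
evalLetter (a⁻¹ i) = s (suc i) ∘ s 1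

evalA : List ALetter → ℕ → ℕ
evalA []      = id
evalA (x ∷ w) = evalLetter x ∘ evalA w

occ1 : List ℕ → ℕ
occ1 []      = 0
occ1 (i ∷ w) = if i ≡ᵇ 1 then suc (occ1 w) else occ1 w

-- Element of R^S_j with k letters (0 ≤ k ≤ j): s_j s_{j-1} ⋯ s_{j-k+1}
RS : ℕ → ℕ → List ℕ
RS j zero    = []
RS j (suc k) = j ∷ RS (pred j) k

posA : ℕ → ℕ → List ALetter
posA j zero    = []
posA j (suc c) = a j ∷ posA (pred j) c

-- Element of R^A_j with index c (0 ≤ c ≤ j+1):
--   c ≤ j   : a_j a_{j-1} ⋯ a_{j-c+1}   (c = 0 gives 1, c = j gives a_j ⋯ a_1)
--   c = j+1 : a_j ⋯ a_2 a_1^{-1}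
RA : ℕ → ℕ → List ALetter
RA j c = if c ≡ᵇ suc j then posA j (pred j) ++ (a⁻¹ 1 ∷ []) else posA j c

SWord : ℕ → (ℕ → ℕ) → List ℕ
SWord zero    ks = []
SWord (suc m) ks = SWord m ks ++ RS (suc m) (ks (suc m))

AWord : ℕ → (ℕ → ℕ) → List ALetter
AWord zero    cs = []
AWord (suc m) cs = AWord m cs ++ RA (suc m) (cs (suc m))

module Submission where

open import Defs
open import Data.Bool using (T; true; false)
open import Data.Bool.Properties using (T-≡; ¬-not)
open import Data.Nat using (ℕ; zero; suc; pred; _≡ᵇ_; _≤_; _<_; _∸_; _+_; z≤n; s≤s; s<s⁻¹)
open import Data.Nat.Properties
open import Data.List using (List; []; _∷_; _++_; length; reverse; replicate)
open import Data.List.Properties using (length-++; unfold-reverse)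
open import Data.List.Membership.Propositional using (_∈_; _∉_)
open import Data.List.Relation.Unary.Any using (here; there)
open import Data.List.Relation.Unary.All as All using (All; []; _∷_)
open import Data.List.Relation.Unary.All.Properties using (++⁺; replicate⁺)
open import Data.Product using (_×_; _,_; proj₁; proj₂; ∃; ∃₂)
open import Data.Sum using (inj₁; inj₂)
open import Function using (_∘_)
open import Function.Bundles using (Equivalence)
open import Relation.Nullary using (yes; no; contradiction)
open import Relation.Binary.PropositionalEquality

-- Modulo powers of s₁, every v ∈ R^A_m is an element r ∈ R^S_{m+1}:
-- v = s₁^e r with ℓ_A(v) = ℓ_S(r) − del_S(r).  Moreover r s₁ = s₁^e' r' with r' ∈ R^S_{m+1} and ℓ_S − del_S unchanged
-- (s_{m+1}⋯s₂ and s_{m+1}⋯s₁ are exchanged, the other elements commute with s₁).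
-- So from w₁⋯w_{m+1} = v₁⋯v_m s₁^e we get (w₁⋯w_m) w_{m+1} = (v₁⋯v_{m−1} s₁^e'') r'.
-- Both prefixes fix m+2, and an element of R^S_{m+1} is determined by the preimage
-- of m+2; hence w_{m+1} = r', w₁⋯w_m = v₁⋯v_{m−1} s₁^e'', and we recurse on m.

≡ᵇ-refl : ∀ n → (n ≡ᵇ n) ≡ true
≡ᵇ-refl n = Equivalence.to T-≡ (≡⇒≡ᵇ n n refl)

≡ᵇ-false : ∀ {m n} → m ≢ n → (m ≡ᵇ n) ≡ false
≡ᵇ-false {m} {n} m≢n = ¬-not (m≢n ∘ ≡ᵇ⇒≡ m n ∘ Equivalence.from T-≡)

s-left : ∀ i → s i i ≡ suc i
s-left i rewrite ≡ᵇ-refl i = refl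

s-right : ∀ i → s i (suc i) ≡ i
s-right i rewrite ≡ᵇ-false (1+n≢n {i}) | ≡ᵇ-refl i = refl

s-other : ∀ {i x} → x ≢ i → x ≢ suc i → s i x ≡ x
s-other x≢i x≢1+i rewrite ≡ᵇ-false x≢i | ≡ᵇ-false x≢1+i = refl

s-involutive : ∀ i x → s i (s i x) ≡ x
s-involutive i x with x ≟ i
... | yes refl rewrite s-left x = s-right x
... | no x≢i with x ≟ suc i
...   | yes refl rewrite s-right i = s-left i
...   | no x≢1+i rewrite s-other x≢i x≢1+i = s-other x≢i x≢1+i

s-injective : ∀ i {x y} → s i x ≡ s i y → x ≡ y
s-injective i {x} {y} eq =
  trans (sym (s-involutive i x)) (trans (cong (s i) eq) (s-involutive i y))

s-comm-disjoint : ∀ {i j} → i ≢ j → i ≢ suc j → suc i ≢ j → suc i ≢ suc j →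
                  ∀ x → s i (s j x) ≡ s j (s i x)
s-comm-disjoint {i} {j} i≢j i≢1+j 1+i≢j 1+i≢1+j x with x ≟ i
... | yes refl rewrite s-other i≢j i≢1+j | s-left x | s-other 1+i≢j 1+i≢1+j = refl
... | no x≢i with x ≟ suc i
...   | yes refl rewrite s-other 1+i≢j 1+i≢1+j | s-right i | s-other i≢j i≢1+j = refl
...   | no x≢1+i with x ≟ j
...     | yes refl rewrite s-left x | s-other (≢-sym i≢1+j) (≢-sym 1+i≢1+j)
                         | s-other x≢i x≢1+i = sym (s-left x)
...     | no x≢j with x ≟ suc j
...       | yes refl rewrite s-right j | s-other (≢-sym i≢j) (≢-sym 1+i≢j)
                           | s-other x≢i x≢1+i = sym (s-right j)
...       | no x≢1+j rewrite s-other x≢j x≢1+j | s-other x≢i x≢1+i = sym (s-other x≢j x≢1+j)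

s-comm : ∀ {i j} → suc i < j → ∀ x → s i (s j x) ≡ s j (s i x)
s-comm {i} {j} 1+i<j =
  s-comm-disjoint (<⇒≢ i<j) (<⇒≢ (m≤n⇒m≤1+n i<j)) (<⇒≢ 1+i<j) (<⇒≢ (s≤s i<j))
  where
  i<j : i < j
  i<j = <-trans (n<1+n i) 1+i<j

evalS-++ : ∀ u v x → evalS (u ++ v) x ≡ evalS u (evalS v x)
evalS-++ []      v x = refl
evalS-++ (i ∷ u) v x = cong (s i) (evalS-++ u v x)

evalA-++ : ∀ u v x → evalA (u ++ v) x ≡ evalA u (evalA v x)
evalA-++ []      v x = refl
evalA-++ (l ∷ u) v x = cong (evalLetter l) (evalA-++ u v x)

evalS-injective : ∀ w {x y} → evalS w x ≡ evalS w y → x ≡ y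
evalS-injective []      eq = eq
evalS-injective (i ∷ w) eq = evalS-injective w (s-injective i eq)

evalS-reverse : ∀ w x → evalS w (evalS (reverse w) x) ≡ x
evalS-reverse []      x = refl
evalS-reverse (i ∷ w) x = begin
  s i (evalS w (evalS (reverse (i ∷ w)) x))
    ≡⟨ cong (λ v → s i (evalS w (evalS v x))) (unfold-reverse i w) ⟩
  s i (evalS w (evalS (reverse w ++ i ∷ []) x))
    ≡⟨ cong (s i ∘ evalS w) (evalS-++ (reverse w) (i ∷ []) x) ⟩
  s i (evalS w (evalS (reverse w) (s i x)))
    ≡⟨ cong (s i) (evalS-reverse w (s i x)) ⟩
  s i (s i x)
    ≡⟨ s-involutive i x ⟩
  x ∎
  where open ≡-Reasoning

evalS-cancelʳ : ∀ u v w → evalS (u ++ v) ≗ evalS (w ++ v) → evalS u ≗ evalS w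
evalS-cancelʳ u v w eq x = begin
  evalS u x                             ≡⟨ cong (evalS u) (sym (evalS-reverse v x)) ⟩
  evalS u (evalS v (evalS (reverse v) x)) ≡⟨ sym (evalS-++ u v _) ⟩
  evalS (u ++ v) (evalS (reverse v) x)  ≡⟨ eq _ ⟩
  evalS (w ++ v) (evalS (reverse v) x)  ≡⟨ evalS-++ w v _ ⟩
  evalS w (evalS v (evalS (reverse v) x)) ≡⟨ cong (evalS w) (evalS-reverse v x) ⟩
  evalS w x                             ∎
  where open ≡-Reasoning

evalS-fix : ∀ {m w} → All (_≤ m) w → evalS w (suc (suc m)) ≡ suc (suc m)
evalS-fix []           = refl
evalS-fix (i≤m ∷ w≤m) rewrite evalS-fix w≤m =
  s-other (≢-sym (<⇒≢ (s≤s (m≤n⇒m≤1+n i≤m)))) (≢-sym (<⇒≢ (s≤s (s≤s i≤m))))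

toS : List ALetter → List ℕ
toS []          = []
toS (a i ∷ w)   = 1 ∷ suc i ∷ toS w
toS (a⁻¹ i ∷ w) = suc i ∷ 1 ∷ toS w

toS-++ : ∀ u v → toS (u ++ v) ≡ toS u ++ toS v
toS-++ []          v = refl
toS-++ (a i ∷ u)   v = cong (λ w → 1 ∷ suc i ∷ w) (toS-++ u v)
toS-++ (a⁻¹ i ∷ u) v = cong (λ w → suc i ∷ 1 ∷ w) (toS-++ u v)

evalA-toS : ∀ w x → evalA w x ≡ evalS (toS w) x
evalA-toS []          x = refl
evalA-toS (a i ∷ w)   x = cong (s 1 ∘ s (suc i)) (evalA-toS w x)
evalA-toS (a⁻¹ i ∷ w) x = cong (s (suc i) ∘ s 1) (evalA-toS w x)

s₁^ : ℕ → ℕ → ℕ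
s₁^ e = evalS (replicate e 1)

s₁^-+ : ∀ e e′ x → s₁^ (e + e′) x ≡ s₁^ e (s₁^ e′ x)
s₁^-+ zero    e′ x = refl
s₁^-+ (suc e) e′ x = cong (s 1) (s₁^-+ e e′ x)

s-comm-s₁^ : ∀ {j} → 2 < j → ∀ e x → s j (s₁^ e x) ≡ s₁^ e (s j x)
s-comm-s₁^ 2<j zero    x = refl
s-comm-s₁^ 2<j (suc e) x =
  trans (sym (s-comm 2<j (s₁^ e x))) (cong (s 1) (s-comm-s₁^ 2<j e x))

evalS-comm-s₁^ : ∀ {w} → All (2 <_) w → ∀ e x → evalS w (s₁^ e x) ≡ s₁^ e (evalS w x)
evalS-comm-s₁^ []           e x = refl
evalS-comm-s₁^ (2<i ∷ w>2) e x =
  trans (cong (s _) (evalS-comm-s₁^ w>2 e x)) (s-comm-s₁^ 2<i e _)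

R : ℕ → ℕ → ℕ → ℕ
R j k = evalS (RS j k)

R-suc : ∀ j k x → R j (suc k) x ≡ R j k (s (j ∸ k) x)
R-suc j       zero    x = refl
R-suc zero    (suc k) x =
  cong (s 0) (trans (R-suc 0 k x) (cong (λ t → R 0 k (s t x)) (0∸n≡0 k)))
R-suc (suc j) (suc k) x = cong (s (suc j)) (R-suc j k x)

R-full : ∀ m x → R (suc m) (suc m) x ≡ R (suc m) m (s 1 x)
R-full m x = trans (R-suc (suc m) m x) (cong (λ t → R (suc m) m (s t x)) (m+n∸n≡m 1 m))

R-top : ∀ {j k} → k ≤ j → R j k (suc j ∸ k) ≡ suc j
R-top         z≤n       = refl
R-top {suc j} (s≤s k≤j) = trans (cong (s (suc j)) (R-top k≤j)) (s-left (suc j))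

RS-letters-≤ : ∀ j k → All (_≤ j) (RS j k)
RS-letters-≤ j zero    = []
RS-letters-≤ j (suc k) = ≤-refl ∷ All.map (λ i≤ → ≤-trans i≤ pred[n]≤n) (RS-letters-≤ (pred j) k)

RS-letters-> : ∀ j k → All (λ x → j < k + x) (RS j k)
RS-letters-> j zero    = []
RS-letters-> j (suc k) =
  s≤s (m≤n+m j k) ∷ All.map (λ j∸1<k+x → s≤s (≤-trans (n≤1+pred j) j∸1<k+x)) (RS-letters-> (pred j) k)
  where
  n≤1+pred : ∀ n → n ≤ suc (pred n)
  n≤1+pred zero    = z≤n
  n≤1+pred (suc n) = ≤-refl

RS-letters->2 : ∀ {m c} → c < m → All (2 <_) (RS (suc m) c)
RS-letters->2 {m} {c} c<m = All.map 2<x (RS-letters-> (suc m) c)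
  where
  2<x : ∀ {x} → suc m < c + x → 2 < x
  2<x m<c+x = +-cancelˡ-< c 2 _ (≤-<-trans (subst (_≤ suc m) (+-comm 2 c) (s≤s c<m)) m<c+x)

1∈RS⇒< : ∀ {i k} → 1 ∈ RS (suc i) k → i < k
1∈RS⇒< {i} {k} 1∈ = s<s⁻¹ (subst (suc i <_) (+-comm k 1) (All.lookup (RS-letters-> (suc i) k) 1∈))

SWord-letters : ∀ m {ks} → All (_≤ m) (SWord m ks)
SWord-letters zero    = []
SWord-letters (suc m) = ++⁺ (All.map m≤n⇒m≤1+n (SWord-letters m)) (RS-letters-≤ (suc m) _)

-- ℓ_S − del_S

length∸occ1 : List ℕ → ℕ
length∸occ1 w = length w ∸ occ1 w

occ1-++ : ∀ u v → occ1 (u ++ v) ≡ occ1 u + occ1 v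
occ1-++ []      v = refl
occ1-++ (i ∷ u) v with i ≡ᵇ 1
... | true  = cong suc (occ1-++ u v)
... | false = occ1-++ u v

occ1≤length : ∀ w → occ1 w ≤ length w
occ1≤length []      = z≤n
occ1≤length (i ∷ w) with i ≡ᵇ 1
... | true  = s≤s (occ1≤length w)
... | false = m≤n⇒m≤1+n (occ1≤length w)

occ1-∉ : ∀ {w} → 1 ∉ w → occ1 w ≡ 0
occ1-∉ {[]}    _  = refl
occ1-∉ {i ∷ w} 1∉ with i ≡ᵇ 1 in eq
... | true  = contradiction (here (sym (≡ᵇ⇒≡ i 1 (subst T (sym eq) _)))) 1∉
... | false = occ1-∉ (1∉ ∘ there)

length∸occ1-++ : ∀ u v → length∸occ1 (u ++ v) ≡ length∸occ1 u + length∸occ1 v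
length∸occ1-++ u v = begin
  length (u ++ v) ∸ occ1 (u ++ v)          ≡⟨ cong₂ _∸_ (length-++ u) (occ1-++ u v) ⟩
  (length u + length v) ∸ (occ1 u + occ1 v) ≡⟨ sym (∸-+-assoc (length u + length v) (occ1 u) (occ1 v)) ⟩
  (length u + length v) ∸ occ1 u ∸ occ1 v   ≡⟨ cong (_∸ occ1 v) (+-∸-comm (length v) (occ1≤length u)) ⟩
  (length∸occ1 u + length v) ∸ occ1 v       ≡⟨ +-∸-assoc (length∸occ1 u) (occ1≤length v) ⟩
  length∸occ1 u + length∸occ1 v             ∎
  where open ≡-Reasoning

length-RS : ∀ j k → length (RS j k) ≡ k
length-RS j zero    = refl
length-RS j (suc k) = cong suc (length-RS (pred j) k)

occ1-RS-full : ∀ i → occ1 (RS (suc i) (suc i)) ≡ 1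
occ1-RS-full zero    = refl
occ1-RS-full (suc i) = occ1-RS-full i

occ1-RS-∈ : ∀ {i k} → k ≤ suc i → 1 ∈ RS (suc i) k → occ1 (RS (suc i) k) ≡ 1
occ1-RS-∈ {i} k≤ 1∈ rewrite ≤-antisym k≤ (1∈RS⇒< 1∈) = occ1-RS-full i

length∸occ1-RS-≤ : ∀ {m c} → c ≤ m → length∸occ1 (RS (suc m) c) ≡ c
length∸occ1-RS-≤ {m} {c} c≤m
  rewrite occ1-∉ (λ 1∈ → <⇒≱ (1∈RS⇒< {m} {c} 1∈) c≤m) = length-RS (suc m) c

length∸occ1-RS-full : ∀ m → length∸occ1 (RS (suc m) (suc m)) ≡ m
length∸occ1-RS-full m rewrite occ1-RS-full m = length-RS m m

length∸occ1-RS₁ : ∀ {k} → k ≤ 1 → length∸occ1 (RS 1 k) ≡ 0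
length∸occ1-RS₁ z≤n       = refl
length∸occ1-RS₁ (s≤s z≤n) = refl

RA-posA : ∀ {m c} → c ≤ m → RA m c ≡ posA m c
RA-posA c≤m rewrite ≡ᵇ-false (<⇒≢ (s≤s c≤m)) = refl

RA-full : ∀ m → RA m (suc m) ≡ posA m (pred m) ++ a⁻¹ 1 ∷ []
RA-full m rewrite ≡ᵇ-refl m = refl

length-posA : ∀ m c → length (posA m c) ≡ c
length-posA m zero    = refl
length-posA m (suc c) = cong suc (length-posA (pred m) c)

length-RA : ∀ {m c} → 1 ≤ m → c ≤ suc m → length (RA m c) ≡ length∸occ1 (RS (suc m) c)
length-RA {m} {c} _ c≤ with m≤n⇒m<n∨m≡n c≤
... | inj₁ (s≤s c≤m) rewrite RA-posA c≤m | length∸occ1-RS-≤ c≤m = length-posA m c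
length-RA {suc i} _ _ | inj₂ refl rewrite RA-full (suc i) | length∸occ1-RS-full (suc i) =
  trans (length-++ (posA (suc i) i)) (trans (cong (_+ 1) (length-posA (suc i) i)) (+-comm i 1))

toS-posA-letters : ∀ m c → All (_≤ suc m) (toS (posA m c))
toS-posA-letters m zero    = []
toS-posA-letters m (suc c) =
  s≤s z≤n ∷ ≤-refl ∷ All.map (λ i≤ → ≤-trans i≤ (s≤s pred[n]≤n)) (toS-posA-letters (pred m) c)

toS-RA-letters : ∀ {m} c → 1 ≤ m → All (_≤ suc m) (toS (RA m c))
toS-RA-letters {m} c 1≤m with c ≡ᵇ suc m
... | false = toS-posA-letters m c
... | true rewrite toS-++ (posA m (pred m)) (a⁻¹ 1 ∷ []) =
  ++⁺ (toS-posA-letters m (pred m)) (s≤s 1≤m ∷ s≤s z≤n ∷ [])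

toS-AWord-letters : ∀ q {cs} → All (_≤ suc q) (toS (AWord q cs))
toS-AWord-letters zero         = []
toS-AWord-letters (suc q) {cs} rewrite toS-++ (AWord q cs) (RA (suc q) (cs (suc q))) =
  ++⁺ (All.map m≤n⇒m≤1+n (toS-AWord-letters q)) (toS-RA-letters (cs (suc q)) (s≤s z≤n))

evalA-posA : ∀ {m c} → c ≤ m → evalA (posA m c) ≗ s₁^ c ∘ R (suc m) c
evalA-posA {c = zero}      _         x = refl
evalA-posA {suc m} {suc c} (s≤s c≤m) x =
  cong (s 1) (trans (cong (s (suc (suc m))) (evalA-posA c≤m x)) (commute c≤m))
  where
  commute : ∀ {c} → c ≤ m → ∀ {y} → s (suc (suc m)) (s₁^ c y) ≡ s₁^ c (s (suc (suc m)) y)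
  commute z≤n                 = refl
  commute {suc c} (s≤s _) {y} = s-comm-s₁^ (s≤s (s≤s (s≤s z≤n))) (suc c) y

-- The last letter a₁⁻¹ = s₂s₁ of the longest element turns s_{m+1}⋯s₃ into s_{m+1}⋯s₁.
evalA-RA : ∀ {m c} → 1 ≤ m → c ≤ suc m → ∃ λ e → evalA (RA m c) ≗ s₁^ e ∘ R (suc m) c
evalA-RA {m} {c} _ c≤ with m≤n⇒m<n∨m≡n c≤
... | inj₁ (s≤s c≤m) = c , λ x → trans (cong (λ w → evalA w x) (RA-posA c≤m)) (evalA-posA c≤m x)
evalA-RA {suc i} _ _ | inj₂ refl = i , λ x → begin
  evalA (RA (suc i) (suc (suc i))) x
    ≡⟨ cong (λ w → evalA w x) (RA-full (suc i)) ⟩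
  evalA (posA (suc i) i ++ a⁻¹ 1 ∷ []) x
    ≡⟨ evalA-++ (posA (suc i) i) (a⁻¹ 1 ∷ []) x ⟩
  evalA (posA (suc i) i) (s 2 (s 1 x))
    ≡⟨ evalA-posA (n≤1+n i) _ ⟩
  s₁^ i (R (suc (suc i)) i (s 2 (s 1 x)))
    ≡⟨ cong (λ t → s₁^ i (R (suc (suc i)) i (s t (s 1 x)))) (sym (m+n∸n≡m 2 i)) ⟩
  s₁^ i (R (suc (suc i)) i (s (suc (suc i) ∸ i) (s 1 x)))
    ≡⟨ cong (s₁^ i) (sym (R-suc (suc (suc i)) i (s 1 x))) ⟩
  s₁^ i (R (suc (suc i)) (suc i) (s 1 x))
    ≡⟨ cong (s₁^ i) (sym (R-full (suc i) x)) ⟩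
  s₁^ i (R (suc (suc i)) (suc (suc i)) x) ∎
  where open ≡-Reasoning

R-∘-s₁ : ∀ {m c} → c ≤ suc m → ∃₂ λ c′ e → c′ ≤ suc m
  × length∸occ1 (RS (suc m) c′) ≡ length∸occ1 (RS (suc m) c)
  × R (suc m) c ∘ s 1 ≗ s₁^ e ∘ R (suc m) c′
R-∘-s₁ {m} {c} c≤ with m≤n⇒m<n∨m≡n c≤
... | inj₂ refl =
  m , 0 , n≤1+n m , trans (length∸occ1-RS-≤ ≤-refl) (sym (length∸occ1-RS-full m)) ,
  λ x → trans (R-full m (s 1 x)) (cong (R (suc m) m) (s-involutive 1 x))
... | inj₁ (s≤s c≤m) with m≤n⇒m<n∨m≡n c≤m
...   | inj₂ refl =
  suc m , 0 , ≤-refl , trans (length∸occ1-RS-full m) (sym (length∸occ1-RS-≤ ≤-refl)) ,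
  λ x → sym (R-full m x)
...   | inj₁ c<m = c , 1 , c≤ , refl , evalS-comm-s₁^ (RS-letters->2 c<m) 1

R-∘-s₁^ : ∀ {m c} → c ≤ suc m → ∀ e → ∃₂ λ c′ e′ → c′ ≤ suc m
  × length∸occ1 (RS (suc m) c′) ≡ length∸occ1 (RS (suc m) c)
  × R (suc m) c ∘ s₁^ e ≗ s₁^ e′ ∘ R (suc m) c′
R-∘-s₁^ {c = c} c≤ zero = c , 0 , c≤ , refl , λ x → refl
R-∘-s₁^ {m} {c} c≤ (suc e) with R-∘-s₁ c≤
... | c₁ , e₁ , c₁≤ , same₁ , eq₁ with R-∘-s₁^ c₁≤ e
...   | c₂ , e₂ , c₂≤ , same₂ , eq₂ = c₂ , e₁ + e₂ , c₂≤ , trans same₂ same₁ , λ x → begin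
  R (suc m) c (s 1 (s₁^ e x))       ≡⟨ eq₁ (s₁^ e x) ⟩
  s₁^ e₁ (R (suc m) c₁ (s₁^ e x))   ≡⟨ cong (s₁^ e₁) (eq₂ x) ⟩
  s₁^ e₁ (s₁^ e₂ (R (suc m) c₂ x))  ≡⟨ sym (s₁^-+ e₁ e₂ _) ⟩
  s₁^ (e₁ + e₂) (R (suc m) c₂ x)    ∎
  where open ≡-Reasoning

RA-normal-form : ∀ {m c} → 1 ≤ m → c ≤ suc m → ∀ e → ∃₂ λ c′ e′ → c′ ≤ suc m
  × length (RA m c) ≡ length∸occ1 (RS (suc m) c′)
  × evalA (RA m c) ∘ s₁^ e ≗ s₁^ e′ ∘ R (suc m) c′
RA-normal-form {m} {c} 1≤m c≤ e with evalA-RA 1≤m c≤ | R-∘-s₁^ c≤ e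
... | e₁ , eqA | c′ , e₂ , c′≤ , same , eqR =
  c′ , e₁ + e₂ , c′≤ , trans (length-RA 1≤m c≤) (sym same) , λ x → begin
  evalA (RA m c) (s₁^ e x)          ≡⟨ eqA (s₁^ e x) ⟩
  s₁^ e₁ (R (suc m) c (s₁^ e x))    ≡⟨ cong (s₁^ e₁) (eqR x) ⟩
  s₁^ e₁ (s₁^ e₂ (R (suc m) c′ x))  ≡⟨ sym (s₁^-+ e₁ e₂ _) ⟩
  s₁^ (e₁ + e₂) (R (suc m) c′ x)    ∎
  where open ≡-Reasoning

-- u and w fix m + 2, and R (suc m) k sends m + 2 ∸ k to m + 2: k is read off the preimage of m + 2.
top-factor-unique : ∀ {m u w k c} → All (_≤ m) u → All (_≤ m) w → k ≤ suc m → c ≤ suc m →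
  evalS (u ++ RS (suc m) k) ≗ evalS (w ++ RS (suc m) c) → k ≡ c × evalS u ≗ evalS w
top-factor-unique {m} {u} {w} {k} {c} u≤ w≤ k≤ c≤ eq =
  k≡c , evalS-cancelʳ u (RS (suc m) k) w (λ x → trans (eq x) (cong (λ c → evalS (w ++ RS (suc m) c) x) (sym k≡c)))
  where
  open ≡-Reasoning
  X : ℕ
  X = suc (suc m)
  Rc-hits-X : R (suc m) c (X ∸ k) ≡ X
  Rc-hits-X = evalS-injective w (begin
    evalS w (R (suc m) c (X ∸ k))     ≡⟨ sym (evalS-++ w (RS (suc m) c) _) ⟩
    evalS (w ++ RS (suc m) c) (X ∸ k) ≡⟨ sym (eq _) ⟩
    evalS (u ++ RS (suc m) k) (X ∸ k) ≡⟨ evalS-++ u (RS (suc m) k) _ ⟩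
    evalS u (R (suc m) k (X ∸ k))     ≡⟨ cong (evalS u) (R-top k≤) ⟩
    evalS u X                         ≡⟨ evalS-fix u≤ ⟩
    X                                 ≡⟨ sym (evalS-fix w≤) ⟩
    evalS w X                         ∎)
  k≡c : k ≡ c
  k≡c = ∸-cancelˡ-≡ (m≤n⇒m≤1+n k≤) (m≤n⇒m≤1+n c≤)
          (evalS-injective (RS (suc m) c) (trans Rc-hits-X (sym (R-top c≤))))

peel-top : ∀ {m u v k c e} → 1 ≤ m → All (_≤ m) u → All (_≤ m) (toS v) → k ≤ suc m → c ≤ suc m →
  evalS (u ++ RS (suc m) k) ≗ evalA (v ++ RA m c) ∘ s₁^ e →
  length (RA m c) ≡ length∸occ1 (RS (suc m) k) × ∃ λ e′ → evalS u ≗ evalA v ∘ s₁^ e′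
peel-top {m} {u} {v} {k} {c} {e} 1≤m u≤ v≤ k≤ c≤ eq with RA-normal-form 1≤m c≤ e
... | c′ , e′ , c′≤ , len , nf =
  trans len (cong (length∸occ1 ∘ RS (suc m)) (sym (proj₁ unique))) ,
  e′ , λ x → trans (proj₂ unique x) (trans (evalS-++ (toS v) (replicate e′ 1) x) (sym (evalA-toS v _)))
  where
  open ≡-Reasoning
  w = toS v ++ replicate e′ 1
  eq′ : evalS (u ++ RS (suc m) k) ≗ evalS (w ++ RS (suc m) c′)
  eq′ x = begin
    evalS (u ++ RS (suc m) k) x               ≡⟨ eq x ⟩
    evalA (v ++ RA m c) (s₁^ e x)             ≡⟨ evalA-++ v (RA m c) _ ⟩
    evalA v (evalA (RA m c) (s₁^ e x))        ≡⟨ cong (evalA v) (nf x) ⟩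
    evalA v (s₁^ e′ (R (suc m) c′ x))         ≡⟨ evalA-toS v _ ⟩
    evalS (toS v) (s₁^ e′ (R (suc m) c′ x))   ≡⟨ sym (evalS-++ (toS v) (replicate e′ 1) _) ⟩
    evalS w (R (suc m) c′ x)                  ≡⟨ sym (evalS-++ w (RS (suc m) c′) x) ⟩
    evalS (w ++ RS (suc m) c′) x              ∎
  unique : k ≡ c′ × evalS u ≗ evalS w
  unique = top-factor-unique u≤ (++⁺ v≤ (replicate⁺ e′ 1≤m)) k≤ c′≤ eq′

Bounded : ℕ → (ℕ → ℕ) → ℕ → Set
Bounded d f n = ∀ j → 1 ≤ j → j ≤ n → f j ≤ d + j

Bounded-pred : ∀ {d f n} → Bounded d f (suc n) → Bounded d f n
Bounded-pred f≤ j 1≤j j≤n = f≤ j 1≤j (m≤n⇒m≤1+n j≤n)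

level-lengths : ∀ q {ks cs} e → Bounded 0 ks (suc q) → Bounded 1 cs q →
  evalS (SWord (suc q) ks) ≗ evalA (AWord q cs) ∘ s₁^ e →
  ∀ i → 1 ≤ i → i ≤ q → length (RA i (cs i)) ≡ length∸occ1 (RS (suc i) (ks (suc i)))
level-lengths zero    _ _   _   _  _ (s≤s _) ()
level-lengths (suc p) e ks≤ cs≤ eq i 1≤i i≤
  with peel-top {e = e} (s≤s z≤n) (SWord-letters (suc p)) (toS-AWord-letters p)
                (ks≤ _ (s≤s z≤n) ≤-refl) (cs≤ _ (s≤s z≤n) ≤-refl) eq
... | top , e′ , eq′ with m≤n⇒m<n∨m≡n i≤
...   | inj₂ refl       = top
...   | inj₁ (s≤s i≤p) = level-lengths p e′ (Bounded-pred ks≤) (Bounded-pred cs≤) eq′ i 1≤i i≤p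

length-AWord : ∀ q {ks cs} → ks 1 ≤ 1 →
  (∀ i → 1 ≤ i → i ≤ q → length (RA i (cs i)) ≡ length∸occ1 (RS (suc i) (ks (suc i)))) →
  length (AWord q cs) ≡ length∸occ1 (SWord (suc q) ks)
length-AWord zero    ks₁≤1 _ = sym (length∸occ1-RS₁ ks₁≤1)
length-AWord (suc q) {ks} {cs} ks₁≤1 levels = begin
  length (AWord q cs ++ RA (suc q) (cs (suc q)))
    ≡⟨ length-++ (AWord q cs) ⟩
  length (AWord q cs) + length (RA (suc q) (cs (suc q)))
    ≡⟨ cong₂ _+_ (length-AWord q ks₁≤1 (λ i 1≤i i≤q → levels i 1≤i (m≤n⇒m≤1+n i≤q)))
                 (levels (suc q) (s≤s z≤n) ≤-refl) ⟩
  length∸occ1 (SWord (suc q) ks) + length∸occ1 (RS (suc (suc q)) (ks (suc (suc q))))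
    ≡⟨ sym (length∸occ1-++ (SWord (suc q) ks) _) ⟩
  length∸occ1 (SWord (suc (suc q)) ks) ∎
  where open ≡-Reasoning

proposition4p4 : (n : ℕ) → 2 ≤ n →
    (ks : ℕ → ℕ) → ((j : ℕ) → 1 ≤ j → j ≤ n → ks j ≤ j) →
    (cs : ℕ → ℕ) → ((j : ℕ) → 1 ≤ j → j ≤ n ∸ 1 → cs j ≤ j + 1) →
    ((k : ℕ) → evalS (SWord n ks) k ≡ evalA (AWord (n ∸ 1) cs) k) →
    (length (AWord (n ∸ 1) cs) ≡ length (SWord n ks) ∸ occ1 (SWord n ks))
    × ((i : ℕ) → 1 ≤ i → i ≤ n ∸ 1 →
        (1 ∉ RS (i + 1) (ks (i + 1)) →
           length (RA i (cs i)) ≡ length (RS (i + 1) (ks (i + 1))))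
        × (1 ∈ RS (i + 1) (ks (i + 1)) →
           length (RA i (cs i)) ≡ length (RS (i + 1) (ks (i + 1))) ∸ 1))
proposition4p4 (suc (suc q)) (s≤s (s≤s z≤n)) ks ks≤ cs cs≤ eq =
  length-AWord (suc q) (ks≤ 1 ≤-refl (s≤s z≤n)) levels , per-level
  where
  levels : ∀ i → 1 ≤ i → i ≤ suc q → length (RA i (cs i)) ≡ length∸occ1 (RS (suc i) (ks (suc i)))
  levels = level-lengths (suc q) 0 ks≤ (λ j 1≤j j≤ → subst (cs j ≤_) (+-comm j 1) (cs≤ j 1≤j j≤)) eq
  per-level : ∀ i → 1 ≤ i → i ≤ suc q →
    (1 ∉ RS (i + 1) (ks (i + 1)) → length (RA i (cs i)) ≡ length (RS (i + 1) (ks (i + 1))))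
    × (1 ∈ RS (i + 1) (ks (i + 1)) → length (RA i (cs i)) ≡ length (RS (i + 1) (ks (i + 1))) ∸ 1)
  per-level i 1≤i i≤ rewrite +-comm i 1 =
    (λ 1∉ → trans level (cong (length (RS (suc i) (ks (suc i))) ∸_) (occ1-∉ 1∉))) ,
    (λ 1∈ → trans level (cong (length (RS (suc i) (ks (suc i))) ∸_)
                           (occ1-RS-∈ (ks≤ (suc i) (s≤s z≤n) (s≤s i≤)) 1∈)))
    where
    level : length (RA i (cs i)) ≡ length∸occ1 (RS (suc i) (ks (suc i)))
    level = levels i 1≤i i≤
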